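{- Let ${\tt G}$ be a digraph and ${\tt R}$ a stable dynamical region of ${\tt G}$. Then the multipath complex $X({\tt R})$ is the matching complex of the underlying unoriented graph of ${\tt R}$.
   Context: A digraph has a finite vertex set and edges given by ordered pairs of distinct vertices. A multipath is a set of edges in which each vertex has in- and out-degree at most $1$ and which contains no oriented cycle (i.e. a spanning subgraph whose components are vertices or simple directed paths); $X({\tt G})$ is the simplicial complex on $E({\tt G})$ whose simplices are nonempty multipath edge sets. The matching complex of an undirected graph is the simplicial complex on its edge set whose simplices are nonempty sets of pairwise vertex-disjoint edges. A vertex is stable in a digraph ${\tt H}$ if its in-degree or out-degree in ${\tt H}$ is zero, and unstable otherwise. For ${\tt R}\le{\tt G}$, $C_{{\tt G}}({\tt R})$ is the subgraph spanned by $E({\tt G})\setminus E({\tt R})$ and $\partial_{{\tt G}}{\tt R}=V({\tt R})\cap V(C_{{\tt G}}({\tt R}))$. A dynamical region of ${\tt G}$ is a connected full (induced) subgraph ${\tt R}$ with at least one edge such that (a) every vertex of $\partial_{{\tt G}}{\tt R}$ is unstable in ${\tt G}$ but stable in both ${\tt R}$ and $C_{{\tt G}}({\tt R})$; (b) no edge of ${\tt R}$ lies on an oriented cycle of ${\tt G}$ not contained in ${\tt R}$. A dynamical region is stable if all its non-boundary vertices are stable (in ${\tt G}$). -}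

module Defs where

open import Data.Nat using (ℕ; suc; _≤_)
open import Data.Fin using (Fin)
open import Data.Bool using (Bool; true; false; _∧_; _∨_; not)
open import Data.List using (List; []; _∷_; _++_; length)
open import Data.List.Relation.Unary.All using (All)
open import Data.List.Relation.Unary.Linked using (Linked)
open import Data.List.Relation.Unary.Unique.Propositional using (Unique)
open import Data.Product using (Σ; ∃; ∃₂; _×_)
open import Data.Sum using (_⊎_)
open import Data.Empty using (⊥)
open import Relation.Nullary using (¬_)
open import Relation.Binary.PropositionalEquality using (_≡_)
open import Relation.Binary.Construct.Closure.ReflexiveTransitive using (Star)

record Digraph (n : ℕ) : Set where
  field
    E        : Fin n → Fin n → Bool
    loopless : ∀ v → E v v ≡ false
open Digraph public

EdgeSet : ℕ → Set
EdgeSet n = Fin n → Fin n → Bool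

VertexSet : ℕ → Set
VertexSet n = Fin n → Bool

module _ {n : ℕ} where

  _⊆E_ : EdgeSet n → EdgeSet n → Set
  S ⊆E T = ∀ u v → S u v ≡ true → T u v ≡ true

  NonEmptyE : EdgeSet n → Set
  NonEmptyE S = ∃₂ λ u v → S u v ≡ true

  InducedE : Digraph n → VertexSet n → EdgeSet n
  InducedE G W u v = W u ∧ W v ∧ E G u v

  ComplE : Digraph n → VertexSet n → EdgeSet n
  ComplE G W u v = E G u v ∧ not (InducedE G W u v)

  InSpan : EdgeSet n → Fin n → Set
  InSpan S v = ∃ λ u → (S u v ≡ true) ⊎ (S v u ≡ true)

  Stable : EdgeSet n → Fin n → Set
  Stable S v = (∀ u → S u v ≡ false) ⊎ (∀ w → S v w ≡ false)

  Boundary : Digraph n → VertexSet n → Fin n → Set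
  Boundary G W v = (W v ≡ true) × InSpan (ComplE G W) v

  OrientedCycle : EdgeSet n → List (Fin n) → Set
  OrientedCycle S []       = ⊥
  OrientedCycle S (v ∷ vs) =
    (2 ≤ suc (length vs)) × Unique (v ∷ vs) ×
    Linked (λ a b → S a b ≡ true) ((v ∷ vs) ++ (v ∷ []))

  EdgeOnCycle : Fin n → Fin n → List (Fin n) → Set
  EdgeOnCycle a b []       = ⊥
  EdgeOnCycle a b (v ∷ vs) =
    ∃₂ λ xs ys → (v ∷ vs) ++ (v ∷ []) ≡ xs ++ (a ∷ b ∷ ys)

  UAdj : EdgeSet n → Fin n → Fin n → Set
  UAdj S a b = (S a b ≡ true) ⊎ (S b a ≡ true)

  -- Dynamical region: R is the full subgraph of G on the vertex set W.
  record DynamicalRegion (G : Digraph n) (W : VertexSet n) : Set where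
    field
      connected : ∀ u v → W u ≡ true → W v ≡ true → Star (UAdj (InducedE G W)) u v
      hasEdge   : NonEmptyE (InducedE G W)
      boundaryCond : ∀ v → Boundary G W v →
        (¬ Stable (E G) v) × Stable (InducedE G W) v × Stable (ComplE G W) v
      cycleCond : ∀ a b → InducedE G W a b ≡ true →
        ∀ c → OrientedCycle (E G) c → EdgeOnCycle a b c →
        All (λ x → W x ≡ true) c

  record StableDynamicalRegion (G : Digraph n) (W : VertexSet n) : Set where
    field
      region : DynamicalRegion G W
      stableInterior : ∀ v → W v ≡ true → ¬ Boundary G W v → Stable (E G) v

  MultipathSimplex : EdgeSet n → EdgeSet n → Set
  MultipathSimplex EH S =
    (S ⊆E EH) × NonEmptyE S ×
    (∀ u w v → S u v ≡ true → S w v ≡ true → u ≡ w) ×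
    (∀ v u w → S v u ≡ true → S v w ≡ true → u ≡ w) ×
    (∀ c → ¬ OrientedCycle S c)

  UnderlyingE : EdgeSet n → EdgeSet n
  UnderlyingE EH u v = EH u v ∨ EH v u

  -- Simplices of the matching complex of the unoriented graph with
  -- (symmetric) edge relation UE: nonempty sets M of unoriented edges
  -- (symmetric relations M ⊆ UE) that are pairwise vertex-disjoint.
  MatchingSimplex : EdgeSet n → EdgeSet n → Set
  MatchingSimplex UE M =
    (M ⊆E UE) × (∀ u v → M u v ≡ M v u) × NonEmptyE M ×
    (∀ u v w → M u v ≡ true → M u w ≡ true → v ≡ w)

{-# OPTIONS --safe #-}
-- Every vertex of a stable dynamical region R is stable in R: boundary vertices by
-- condition (a), interior vertices because stability in G passes to subgraphs.
-- In a digraph where every vertex is a source or a sink there is no directed path of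
-- length two. Hence a set of edges of R automatically has no oriented cycle, and the
-- degree conditions of a multipath say exactly that no two of its edges share a vertex,
-- which is the matching condition once orientations are forgotten; forgetting
-- orientations is injective because R has no 2-cycles.
module Submission where

open import Defs
open import Data.Nat using (ℕ; s≤s)
open import Data.Bool using (Bool; true; false; _∧_; _∨_; _≟_)
open import Data.Bool.Properties using (∨-comm; ∧-conicalʳ; ∧-distribˡ-∨; ¬-not)
open import Data.Product using (_×_; Σ; _,_; proj₁; proj₂)
open import Data.Sum using (_⊎_; inj₁; inj₂; [_,_])
open import Data.Empty using (⊥; ⊥-elim)
open import Data.Fin.Properties using (any?)
open import Data.List using ([]; _∷_)
open import Data.List.Relation.Unary.Linked using (_∷_)
open import Function.Bundles using (_⇔_; mk⇔)
open import Relation.Nullary using (¬_; yes; no)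
open import Relation.Unary using (Decidable)
open import Relation.Binary.PropositionalEquality using (_≡_; refl; sym; cong)
open Relation.Binary.PropositionalEquality.≡-Reasoning

private
  true≢false : ∀ {b : Bool} → b ≡ true → b ≡ false → ⊥
  true≢false refl ()

  ∨-true-split : ∀ x y → x ∨ y ≡ true → (x ≡ true) ⊎ (y ≡ true)
  ∨-true-split true  _ _ = inj₁ refl
  ∨-true-split false _ p = inj₂ p

  ∨-trueˡ : ∀ {x} y → x ≡ true → x ∨ y ≡ true
  ∨-trueˡ _ refl = refl

  ∨-trueʳ : ∀ x {y} → y ≡ true → x ∨ y ≡ true
  ∨-trueʳ true  _ = refl
  ∨-trueʳ false p = p

  ∧-implied : ∀ x y → (x ≡ true → y ≡ true) → x ∧ y ≡ x
  ∧-implied false _ _ = refl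
  ∧-implied true  _ p = p refl

module _ {n : ℕ} where

  AllStable : EdgeSet n → Set
  AllStable S = ∀ v → Stable S v

  InDegree≤1 : EdgeSet n → Set
  InDegree≤1 S = ∀ u w v → S u v ≡ true → S w v ≡ true → u ≡ w

  OutDegree≤1 : EdgeSet n → Set
  OutDegree≤1 S = ∀ v u w → S v u ≡ true → S v w ≡ true → u ≡ w

  Matching : EdgeSet n → Set
  Matching M = ∀ u v w → M u v ≡ true → M u w ≡ true → v ≡ w

  ⊆E-false : ∀ {S T : EdgeSet n} → S ⊆E T → ∀ u v → T u v ≡ false → S u v ≡ false
  ⊆E-false {S} sub u v f with S u v in e
  ... | false = refl
  ... | true  = ⊥-elim (true≢false (sub u v e) f)

  Stable-⊆E : ∀ {S T : EdgeSet n} → S ⊆E T → ∀ v → Stable T v → Stable S v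
  Stable-⊆E sub v (inj₁ noIn)  = inj₁ λ u → ⊆E-false sub u v (noIn u)
  Stable-⊆E sub v (inj₂ noOut) = inj₂ λ w → ⊆E-false sub v w (noOut w)

  AllStable-⊆E : ∀ {S T : EdgeSet n} → S ⊆E T → AllStable T → AllStable S
  AllStable-⊆E sub st v = Stable-⊆E sub v (st v)

  Stable⇒¬path₂ : ∀ (S : EdgeSet n) v → Stable S v →
    ∀ u w → S u v ≡ true → S v w ≡ true → ⊥
  Stable⇒¬path₂ S v (inj₁ noIn)  u w p _ = true≢false p (noIn u)
  Stable⇒¬path₂ S v (inj₂ noOut) u w _ q = true≢false q (noOut w)

  AllStable⇒asymmetric : ∀ (S : EdgeSet n) → AllStable S →
    ∀ u v → S u v ≡ true → S v u ≡ true → ⊥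
  AllStable⇒asymmetric S st u v p q = Stable⇒¬path₂ S v (st v) u u p q

  AllStable⇒acyclic : ∀ (S : EdgeSet n) → AllStable S → ∀ c → ¬ OrientedCycle S c
  AllStable⇒acyclic S st (v ∷ [])           (s≤s () , _)
  AllStable⇒acyclic S st (v ∷ v₁ ∷ [])      (_ , _ , p ∷ q ∷ _) =
    Stable⇒¬path₂ S v₁ (st v₁) v v p q
  AllStable⇒acyclic S st (v ∷ v₁ ∷ v₂ ∷ vs) (_ , _ , p ∷ q ∷ _) =
    Stable⇒¬path₂ S v₁ (st v₁) v v₂ p q

  UnderlyingE-⊆E : ∀ {S T : EdgeSet n} → S ⊆E T → UnderlyingE S ⊆E UnderlyingE T
  UnderlyingE-⊆E {S} {T} sub u v p =
    [ (λ q → ∨-trueˡ (T v u) (sub u v q)) , (λ q → ∨-trueʳ (T u v) (sub v u q)) ]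
      (∨-true-split (S u v) (S v u) p)

  UnderlyingE-symmetric : ∀ (S : EdgeSet n) u v → UnderlyingE S u v ≡ UnderlyingE S v u
  UnderlyingE-symmetric S u v = ∨-comm (S u v) (S v u)

  UnderlyingE-nonEmpty : ∀ {S : EdgeSet n} → NonEmptyE S → NonEmptyE (UnderlyingE S)
  UnderlyingE-nonEmpty {S} (u , v , p) = u , v , ∨-trueˡ (S v u) p

  nonEmpty-UnderlyingE : ∀ {S : EdgeSet n} → NonEmptyE (UnderlyingE S) → NonEmptyE S
  nonEmpty-UnderlyingE {S} (u , v , p) with ∨-true-split (S u v) (S v u) p
  ... | inj₁ q = u , v , q
  ... | inj₂ q = v , u , q

  Matching⇒InDegree≤1 : ∀ (S : EdgeSet n) → Matching (UnderlyingE S) → InDegree≤1 S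
  Matching⇒InDegree≤1 S m u w v p q = m v u w (∨-trueʳ (S v u) p) (∨-trueʳ (S v w) q)

  Matching⇒OutDegree≤1 : ∀ (S : EdgeSet n) → Matching (UnderlyingE S) → OutDegree≤1 S
  Matching⇒OutDegree≤1 S m v u w p q = m v u w (∨-trueˡ (S u v) p) (∨-trueˡ (S w v) q)

  -- An edge entering u and one leaving u would form a path of length two through u.
  degrees⇒Matching : ∀ (S : EdgeSet n) → AllStable S →
    InDegree≤1 S → OutDegree≤1 S → Matching (UnderlyingE S)
  degrees⇒Matching S st indeg outdeg u v w p q
    with ∨-true-split (S u v) (S v u) p | ∨-true-split (S u w) (S w u) q
  ... | inj₁ uv | inj₁ uw = outdeg u v w uv uw
  ... | inj₂ vu | inj₂ wu = indeg v w u vu wu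
  ... | inj₁ uv | inj₂ wu = ⊥-elim (Stable⇒¬path₂ S u (st u) w v wu uv)
  ... | inj₂ vu | inj₁ uw = ⊥-elim (Stable⇒¬path₂ S u (st u) v w vu uw)

  multipath⇔matching : ∀ (R S : EdgeSet n) → AllStable R → S ⊆E R →
    MultipathSimplex R S ⇔ MatchingSimplex (UnderlyingE R) (UnderlyingE S)
  multipath⇔matching R S stR sub = mk⇔ to from
    where
    stS : AllStable S
    stS = AllStable-⊆E sub stR

    to : MultipathSimplex R S → MatchingSimplex (UnderlyingE R) (UnderlyingE S)
    to (_ , ne , indeg , outdeg , _) =
      UnderlyingE-⊆E sub , UnderlyingE-symmetric S , UnderlyingE-nonEmpty ne ,
      degrees⇒Matching S stS indeg outdeg

    from : MatchingSimplex (UnderlyingE R) (UnderlyingE S) → MultipathSimplex R S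
    from (_ , _ , ne , m) =
      sub , nonEmpty-UnderlyingE ne , Matching⇒InDegree≤1 S m ,
      Matching⇒OutDegree≤1 S m , AllStable⇒acyclic S stS

  -- Orient each edge of M as it is oriented in R.
  matching-orientation : ∀ (R M : EdgeSet n) → M ⊆E UnderlyingE R →
    (∀ u v → M u v ≡ M v u) →
    Σ (EdgeSet n) (λ S → (S ⊆E R) × (∀ u v → UnderlyingE S u v ≡ M u v))
  matching-orientation R M sub sym-M =
    (λ u v → M u v ∧ R u v) , (λ u v → ∧-conicalʳ (M u v) (R u v)) , forget
    where
    forget : ∀ u v → (M u v ∧ R u v) ∨ (M v u ∧ R v u) ≡ M u v
    forget u v = begin
      (M u v ∧ R u v) ∨ (M v u ∧ R v u) ≡⟨ cong (λ b → (M u v ∧ R u v) ∨ (b ∧ R v u)) (sym (sym-M u v)) ⟩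
      (M u v ∧ R u v) ∨ (M u v ∧ R v u) ≡⟨ sym (∧-distribˡ-∨ (M u v) (R u v) (R v u)) ⟩
      M u v ∧ UnderlyingE R u v          ≡⟨ ∧-implied (M u v) (UnderlyingE R u v) (sub u v) ⟩
      M u v                              ∎

  boundary? : ∀ (G : Digraph n) (W : VertexSet n) → Decidable (Boundary G W)
  boundary? G W v with W v ≟ true | any? (λ u → UnderlyingE (ComplE G W) u v ≟ true)
  ... | no  ∉W   | _            = no λ b → ∉W (proj₁ b)
  ... | yes ∈W   | yes (u , p)  = yes (∈W , u , ∨-true-split _ _ p)
  ... | yes _    | no  isolated = no λ
    { (_ , u , inj₁ p) → isolated (u , ∨-trueˡ _ p)
    ; (_ , u , inj₂ p) → isolated (u , ∨-trueʳ _ p) }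

  InducedE-⊆E : ∀ (G : Digraph n) (W : VertexSet n) → InducedE G W ⊆E E G
  InducedE-⊆E G W u v p = ∧-conicalʳ (W v) (E G u v) (∧-conicalʳ (W u) (W v ∧ E G u v) p)

  InducedE-stable-outside : ∀ (G : Digraph n) (W : VertexSet n) v →
    W v ≡ false → Stable (InducedE G W) v
  InducedE-stable-outside G W v ∉W = inj₁ λ u → noEdgeInto (W u) (E G u v)
    where
    noEdgeInto : ∀ a b → a ∧ W v ∧ b ≡ false
    noEdgeInto false _ = refl
    noEdgeInto true  _ rewrite ∉W = refl

  StableDynamicalRegion⇒AllStable : ∀ {G : Digraph n} {W : VertexSet n} →
    StableDynamicalRegion G W → AllStable (InducedE G W)
  StableDynamicalRegion⇒AllStable {G} {W} sdr v with W v ≟ true | boundary? G W v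
  ... | no  ∉W | _      = InducedE-stable-outside G W v (¬-not ∉W)
  ... | yes _  | yes ∂v =
    proj₁ (proj₂ (DynamicalRegion.boundaryCond (StableDynamicalRegion.region sdr) v ∂v))
  ... | yes ∈W | no ¬∂v =
    Stable-⊆E (InducedE-⊆E G W) v (StableDynamicalRegion.stableInterior sdr v ∈W ¬∂v)

lemma4p8 : {n : ℕ} (G : Digraph n) (W : VertexSet n) →
    StableDynamicalRegion G W →
    -- forgetting orientation is a bijection E(R) → E(underlying graph of R)
    (∀ u v → InducedE G W u v ≡ true → InducedE G W v u ≡ true → ⊥) ×
    -- under this bijection the simplices of X(R) are exactly those of the matching complex
    (∀ (S : EdgeSet n) → S ⊆E InducedE G W →
      (MultipathSimplex (InducedE G W) S ⇔
       MatchingSimplex (UnderlyingE (InducedE G W)) (UnderlyingE S))) ×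
    (∀ (M : EdgeSet n) → MatchingSimplex (UnderlyingE (InducedE G W)) M →
      Σ (EdgeSet n) (λ S → (S ⊆E InducedE G W) × (∀ u v → UnderlyingE S u v ≡ M u v)))
lemma4p8 G W sdr =
  AllStable⇒asymmetric R stable ,
  (λ S → multipath⇔matching R S stable) ,
  (λ M (sub , sym-M , _) → matching-orientation R M sub sym-M)
  where
  R = InducedE G W
  stable = StableDynamicalRegion⇒AllStable sdr
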